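{- In a biased $(b:2)$ game (Maker claims $b$ elements per move, Breaker claims $2$ per move, Maker moves first) whose family of winning sets consists of $k+1$ pairwise disjoint sets, each of size at most $s$, Maker wins if $$s\leq\left(\left\lfloor\frac b2\right\rfloor-1\right)\sum_{i=1}^{k-1}\frac1i.$$
   Context: In a biased $(a:b)$ positional game on a finite board, Maker and Breaker alternately claim previously unclaimed elements, Maker $a$ per move and Breaker $b$ per move; Maker wins if he claims all elements of some winning set. -}

module Defs where

open import Data.Nat as ℕ using (ℕ; zero; suc; _⊓_)
open import Data.Nat.DivMod using (_/_)
open import Data.Fin using (Fin)
open import Data.Fin.Subset using (Subset; _⊆_; _∪_; ∁; ∣_∣)
open import Data.Integer using (+_)
open import Data.Rational as ℚ using (ℚ; 0ℚ; 1ℚ)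
open import Relation.Binary.PropositionalEquality using (_≡_)

-- A position is (M , B): the elements claimed so far by Maker and by Breaker;
-- the unclaimed elements are ∁ (M ∪ B). Maker is to move.
-- Since the tree is inductive (finite), a game that ends with the board full and no
-- winning set owned by Maker is not a Maker win.
data MakerWins (a b : ℕ) {m n : ℕ} (F : Fin m → Subset n) :
               Subset n → Subset n → Set where
  won  : ∀ {M B} (i : Fin m) → F i ⊆ M → MakerWins a b F M B
  move : ∀ {M B} (A : Subset n) →
         A ⊆ ∁ (M ∪ B) →
         ∣ A ∣ ≡ a ⊓ ∣ ∁ (M ∪ B) ∣ →
         (∀ (C : Subset n) →
            C ⊆ ∁ ((M ∪ A) ∪ B) →
            ∣ C ∣ ≡ b ⊓ ∣ ∁ ((M ∪ A) ∪ B) ∣ →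
            MakerWins a b F (M ∪ A) (B ∪ C)) →
         MakerWins a b F M B

ℕ→ℚ : ℕ → ℚ
ℕ→ℚ n = (+ n) ℚ./ 1

H : ℕ → ℚ
H zero = 0ℚ
H (suc r) = H r ℚ.+ ((+ 1) ℚ./ suc r)

-- ⌊b/2⌋ - 1 as a rational (may be negative).
halfMinusOne : ℕ → ℚ
halfMinusOne b = ℕ→ℚ (b / 2) ℚ.- 1ℚ

{-# OPTIONS --safe #-}

-- Maker plays a box game on the k + 1 disjoint winning sets ("boxes"). For the boxes still
-- untouched by Breaker he keeps caps on the number of elements he still needs, balanced so
-- that every cap is D or D + 1. A move spends his b claims lowering the largest caps by one
-- each, claiming an element of a box whenever it is not yet complete; and as soon as some
-- live box needs at most b elements he completes it. Breaker's 2 elements kill at most 2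
-- boxes, and because the caps are balanced the r survivors of r + 2 boxes carry a total of
-- at most r (S + 2) / (r + 2), S being the total after Maker's move. With q = ⌊b/2⌋ - 1 this
-- keeps the total cap of r live boxes below q (r H_{r-2} + 4): for r ≤ 2 that bound forces
-- a box needing at most b elements, and at the start, r = k + 1, it is the hypothesis
-- s ≤ q H_{k-1}.

module Submission where

open import Defs
open import Data.Nat using (ℕ; zero; suc; _+_; _*_; _∸_; _≤_; _<_; _⊓_; _!; z≤n; s≤s; NonZero)
open import Data.Nat.Properties
open import Data.Nat.DivMod using (_/_; m/n*n≤m)
open import Data.Nat.Tactic.RingSolver using (solve-∀)
open import Algebra.Properties.CommutativeSemigroup *-commutativeSemigroup using (x∙yz≈y∙xz)
open import Data.Integer as ℤ using (+_)
import Data.Integer.Properties as ℤ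
open import Data.Rational as ℚ using (ℚ)
import Data.Rational.Properties as ℚ
open import Data.Rational.Unnormalised as ℚᵘ using (ℚᵘ; *≡*; *≤*)
import Data.Rational.Unnormalised.Properties as ℚᵘ
open import Data.Fin as Fin using (Fin)
open import Data.Fin.Subset
open import Data.Fin.Subset.Properties
open import Data.Vec using (_∷_; here; there)
open import Data.List using (List; []; _∷_; length; take; allFin)
open import Data.List.Properties using (length-take; length-tabulate)
open import Data.List.Relation.Unary.All as All using (All; []; _∷_)
open import Data.List.Relation.Unary.AllPairs using (AllPairs; []; _∷_)
open import Data.List.Relation.Unary.Unique.Propositional.Properties using (allFin⁺)
open import Data.List.Relation.Binary.Sublist.Propositional as Sublist using ([]; _∷_; _∷ʳ_)
open import Data.List.Relation.Binary.Sublist.Propositional.Properties using (All-resp-⊆; take-⊆)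
open import Data.Product using (∃-syntax; _×_; _,_; proj₁; proj₂)
open import Data.Sum using (_⊎_; inj₁; inj₂; [_,_]′)
import Data.Sum as Sum
open import Data.Empty using (⊥-elim) renaming (⊥ to ∅)
open import Function using (id; _∘_)
open import Relation.Nullary using (yes; no)
open import Relation.Binary.PropositionalEquality

∣⁅x⁆∪p∣≡1+∣p∣ : ∀ {k} {x : Fin k} {p} → x ∉ p → ∣ ⁅ x ⁆ ∪ p ∣ ≡ suc ∣ p ∣
∣⁅x⁆∪p∣≡1+∣p∣ {x = Fin.zero} {p = inside  ∷ p} x∉p = ⊥-elim (x∉p here)
∣⁅x⁆∪p∣≡1+∣p∣ {x = Fin.zero} {p = outside ∷ p} x∉p = cong (suc ∘ ∣_∣) (∪-identityˡ p)
∣⁅x⁆∪p∣≡1+∣p∣ {x = Fin.suc x}{p = inside  ∷ p} x∉p = cong suc (∣⁅x⁆∪p∣≡1+∣p∣ (x∉p ∘ there))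
∣⁅x⁆∪p∣≡1+∣p∣ {x = Fin.suc x}{p = outside ∷ p} x∉p = ∣⁅x⁆∪p∣≡1+∣p∣ (x∉p ∘ there)

∣∁p∣≡1+∣∁[p∪⁅x⁆]∣ : ∀ {k} {x : Fin k} {p} → x ∉ p → ∣ ∁ p ∣ ≡ suc ∣ ∁ (p ∪ ⁅ x ⁆) ∣
∣∁p∣≡1+∣∁[p∪⁅x⁆]∣ {x = Fin.zero} {p = inside  ∷ p} x∉p = ⊥-elim (x∉p here)
∣∁p∣≡1+∣∁[p∪⁅x⁆]∣ {x = Fin.zero} {p = outside ∷ p} x∉p = cong (suc ∘ ∣_∣ ∘ ∁) (sym (∪-identityʳ p))
∣∁p∣≡1+∣∁[p∪⁅x⁆]∣ {x = Fin.suc x}{p = inside  ∷ p} x∉p = ∣∁p∣≡1+∣∁[p∪⁅x⁆]∣ (x∉p ∘ there)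
∣∁p∣≡1+∣∁[p∪⁅x⁆]∣ {x = Fin.suc x}{p = outside ∷ p} x∉p = cong suc (∣∁p∣≡1+∣∁[p∪⁅x⁆]∣ (x∉p ∘ there))

x∈p⇒0<∣p∣ : ∀ {k} {x : Fin k} {p} → x ∈ p → 0 < ∣ p ∣
x∈p⇒0<∣p∣ x∈p = ≤-<-trans z≤n (x∈p⇒∣p-x∣<∣p∣ x∈p)

Empty⇒∣p∣≡0 : ∀ {k} {p : Subset k} → Empty p → ∣ p ∣ ≡ 0
Empty⇒∣p∣≡0 {k} p-empty = trans (cong ∣_∣ (Empty-unique p-empty)) (∣⊥∣≡0 k)

AllPairs-resp-⊇ : ∀ {A : Set} {R : A → A → Set} {xs ys} → ys Sublist.⊆ xs → AllPairs R xs → AllPairs R ys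
AllPairs-resp-⊇ []         []         = []
AllPairs-resp-⊇ (_ ∷ʳ σ)   (_ ∷ rs)   = AllPairs-resp-⊇ σ rs
AllPairs-resp-⊇ (refl ∷ σ) (r ∷ rs)   = All-resp-⊆ σ r ∷ AllPairs-resp-⊇ σ rs

-- Removing β of β + r balanced caps of total S leaves r caps of total at most r (S + β) / (β + r).
balanced-removal : ∀ β r D h h′ → h′ ≤ h → h′ ≤ r →
                   (β + r) * (r * D + h′) ≤ r * ((β + r) * D + h + β)
balanced-removal β r D h h′ h′≤h h′≤r = begin
  (β + r) * (r * D + h′)          ≡⟨ expand-left β r D h′ ⟩
  r * ((β + r) * D) + (β + r) * h′ ≤⟨ +-monoʳ-≤ (r * ((β + r) * D)) excess-bound ⟩
  r * ((β + r) * D) + r * (h + β)  ≡⟨ expand-right β r D h ⟩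
  r * ((β + r) * D + h + β)        ∎
  where
  open ≤-Reasoning
  expand-left : ∀ β r D h′ → (β + r) * (r * D + h′) ≡ r * ((β + r) * D) + (β + r) * h′
  expand-left = solve-∀
  expand-right : ∀ β r D h → r * ((β + r) * D) + r * (h + β) ≡ r * ((β + r) * D + h + β)
  expand-right = solve-∀
  excess-bound : (β + r) * h′ ≤ r * (h + β)
  excess-bound with ≤-total h r
  ... | inj₁ h≤r = begin
    (β + r) * h′ ≤⟨ *-monoʳ-≤ (β + r) h′≤h ⟩
    (β + r) * h  ≡⟨ trans (*-distribʳ-+ h β r) (+-comm (β * h) (r * h)) ⟩
    r * h + β * h ≤⟨ +-monoʳ-≤ (r * h) (*-monoʳ-≤ β h≤r) ⟩
    r * h + β * r ≡⟨ cong (_+_ (r * h)) (*-comm β r) ⟩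
    r * h + r * β ≡⟨ *-distribˡ-+ r h β ⟨
    r * (h + β) ∎
  ... | inj₂ r≤h = begin
    (β + r) * h′ ≤⟨ *-monoʳ-≤ (β + r) h′≤r ⟩
    (β + r) * r  ≡⟨ *-comm (β + r) r ⟩
    r * (β + r)  ≤⟨ *-monoʳ-≤ r (subst (_≤ h + β) (+-comm r β) (+-monoˡ-≤ β r≤h)) ⟩
    r * (h + β)  ∎

module MakerBreaker (a β : ℕ) {m n : ℕ} (F : Fin m → Subset n) where

  private variable
    c h D : ℕ
    M M′ B C : Subset n
    x : Fin m
    y : Fin n
    xs ys : List (Fin m)

  BreakerToMove : Subset n → Subset n → Set
  BreakerToMove M B = ∀ C → C ⊆ ∁ (M ∪ B) → ∣ C ∣ ≡ β ⊓ ∣ ∁ (M ∪ B) ∣ → MakerWins a β F M (B ∪ C)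

  -- With c claims of the current move still to make at (M , B), Maker can complete the move
  -- so that he wins whatever Breaker answers; he may stop early only if the board is full.
  data MakerTurn : ℕ → Subset n → Subset n → Set where
    stop  : ∀ {c M B} → c ⊓ ∣ ∁ (M ∪ B) ∣ ≡ 0 → BreakerToMove M B → MakerTurn c M B
    claim : ∀ {c M B y} → y ∉ M ∪ B → MakerTurn c (M ∪ ⁅ y ⁆) B → MakerTurn (suc c) M B

  turn⇒move : MakerTurn c M B →
              ∃[ A ] (A ⊆ ∁ (M ∪ B) × ∣ A ∣ ≡ c ⊓ ∣ ∁ (M ∪ B) ∣ × BreakerToMove (M ∪ A) B)
  turn⇒move {M = M} {B} (stop c⊓free≡0 reply) =
    ⊥ , ⊥⊆ , trans (∣⊥∣≡0 n) (sym c⊓free≡0) , subst (λ M → BreakerToMove M B) (sym (∪-identityʳ M)) reply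
  turn⇒move {M = M} {B} (claim {c = c} {y = y} y∉M∪B turn) with turn⇒move turn
  ... | A , A⊆free , ∣A∣≡ , reply =
    ⁅ y ⁆ ∪ A , ⊆free , card , subst (λ M → BreakerToMove M B) (∪-assoc M ⁅ y ⁆ A) reply
    where
    rearrange : (M ∪ ⁅ y ⁆) ∪ B ≡ (M ∪ B) ∪ ⁅ y ⁆
    rearrange = trans (∪-assoc M ⁅ y ⁆ B) (trans (cong (M ∪_) (∪-comm ⁅ y ⁆ B)) (sym (∪-assoc M B ⁅ y ⁆)))
    A⊆free′ : A ⊆ ∁ ((M ∪ B) ∪ ⁅ y ⁆)
    A⊆free′ = subst (λ Z → A ⊆ ∁ Z) rearrange A⊆free
    y∉A : y ∉ A
    y∉A y∈A = x∈p⇒x∉∁p (q⊆p∪q (M ∪ B) ⁅ y ⁆ (x∈⁅x⁆ y)) (A⊆free′ y∈A)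
    ⊆free : ⁅ y ⁆ ∪ A ⊆ ∁ (M ∪ B)
    ⊆free z∈ with x∈p∪q⁻ ⁅ y ⁆ A z∈
    ... | inj₁ z∈⁅y⁆ rewrite x∈⁅y⁆⇒x≡y y z∈⁅y⁆ = x∉p⇒x∈∁p y∉M∪B
    ... | inj₂ z∈A = p⊆q⇒∁p⊇∁q (p⊆p∪q ⁅ y ⁆) (A⊆free′ z∈A)
    card : ∣ ⁅ y ⁆ ∪ A ∣ ≡ suc c ⊓ ∣ ∁ (M ∪ B) ∣
    card = begin
      ∣ ⁅ y ⁆ ∪ A ∣                                 ≡⟨ ∣⁅x⁆∪p∣≡1+∣p∣ y∉A ⟩
      suc ∣ A ∣                                      ≡⟨ cong suc ∣A∣≡ ⟩
      suc c ⊓ suc ∣ ∁ ((M ∪ ⁅ y ⁆) ∪ B) ∣            ≡⟨ cong (λ Z → suc c ⊓ suc ∣ ∁ Z ∣) rearrange ⟩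
      suc c ⊓ suc ∣ ∁ ((M ∪ B) ∪ ⁅ y ⁆) ∣            ≡⟨ cong (suc c ⊓_) (∣∁p∣≡1+∣∁[p∪⁅x⁆]∣ y∉M∪B) ⟨
      suc c ⊓ ∣ ∁ (M ∪ B) ∣                          ∎
      where open ≡-Reasoning

  turn⇒wins : MakerTurn a M B → MakerWins a β F M B
  turn⇒wins turn with turn⇒move turn
  ... | A , A⊆free , ∣A∣≡ , reply = move A A⊆free ∣A∣≡ reply

  claim-arbitrarily : ∀ c → (∀ {M′} → M ⊆ M′ → BreakerToMove M′ B) → MakerTurn c M B
  claim-arbitrarily zero            reply = stop refl (reply id)
  claim-arbitrarily {M} {B} (suc c) reply with nonempty? (∁ (M ∪ B))
  ... | yes (y , y∈free) =
    claim (x∈∁p⇒x∉p y∈free) (claim-arbitrarily c (λ M∪y⊆M′ → reply (M∪y⊆M′ ∘ p⊆p∪q ⁅ y ⁆)))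
  ... | no  full         = stop (cong (suc c ⊓_) (Empty⇒∣p∣≡0 full)) (reply id)

  missing : Subset n → Fin m → Subset n
  missing M x = F x ∩ ∁ M

  need : Subset n → Fin m → ℕ
  need M x = ∣ missing M x ∣

  Untouched : Subset n → Fin m → Set
  Untouched B x = ∀ {y} → y ∈ F x → y ∉ B

  missing-antimono : M ⊆ M′ → missing M′ x ⊆ missing M x
  missing-antimono {x = x} M⊆M′ y∈ with x∈p∩q⁻ (F x) _ y∈
  ... | y∈F , y∉M′ = x∈p∩q⁺ (y∈F , p⊆q⇒∁p⊇∁q M⊆M′ y∉M′)

  need-antimono : M ⊆ M′ → need M′ x ≤ need M x
  need-antimono M⊆M′ = p⊆q⇒∣p∣≤∣q∣ (missing-antimono M⊆M′)

  need-claim : y ∈ missing M x → need (M ∪ ⁅ y ⁆) x < need M x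
  need-claim {y} {M} {x} y∈ = ≤-<-trans (p⊆q⇒∣p∣≤∣q∣ ⊆missing-y) (x∈p⇒∣p-x∣<∣p∣ y∈)
    where
    ⊆missing-y : missing (M ∪ ⁅ y ⁆) x ⊆ missing M x - y
    ⊆missing-y z∈ = x∈p∧x≢y⇒x∈p-y (missing-antimono (p⊆p∪q ⁅ y ⁆) z∈)
                      (λ { refl → x∈∁p⇒x∉p (proj₂ (x∈p∩q⁻ (F x) _ z∈)) (q⊆p∪q M ⁅ y ⁆ (x∈⁅x⁆ y)) })

  nothing-missing : Empty (missing M x) → F x ⊆ M
  nothing-missing {M} {x} none {y} y∈F with y ∈? M
  ... | yes y∈M = y∈M
  ... | no  y∉M = ⊥-elim (none (y , x∈p∩q⁺ (y∈F , x∉p⇒x∈∁p y∉M)))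

  claimable : Untouched B x → y ∈ missing M x → y ∉ M ∪ B
  claimable {x = x} untouched y∈ y∈M∪B with x∈p∩q⁻ (F x) _ y∈ | x∈p∪q⁻ _ _ y∈M∪B
  ... | _   , y∉M | inj₁ y∈M = x∈∁p⇒x∉p y∉M y∈M
  ... | y∈F , _   | inj₂ y∈B = untouched y∈F y∈B

  Finishable : ℕ → Subset n → Subset n → Set
  Finishable c M B = ∃[ x ] (Untouched B x × need M x ≤ c)

  finish : ∀ c → Finishable c M B → MakerTurn c M B
  finish {M} c (x , untouched , need≤c) with nonempty? (missing M x)
  ... | no none = claim-arbitrarily c (λ M⊆M′ _ _ _ → won x (M⊆M′ ∘ nothing-missing none))
  finish zero    (x , untouched , need≤c) | yes (y , y∈) = ⊥-elim (<⇒≱ (x∈p⇒0<∣p∣ y∈) need≤c)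
  finish (suc c) (x , untouched , need≤c) | yes (y , y∈) =
    claim (claimable untouched y∈) (finish c (x , untouched , ≤-pred (<-≤-trans (need-claim y∈) need≤c)))

  -- The boxes xs are untouched by Breaker and each needs at most its cap, D or D + 1, with
  -- exactly h caps equal to D + 1; so the caps add up to length xs * D + h.
  data Balanced (M B : Subset n) (D : ℕ) : List (Fin m) → ℕ → Set where
    []   : Balanced M B D [] 0
    low  : ∀ {x xs h} → Untouched B x → need M x ≤ D →
           Balanced M B D xs h → Balanced M B D (x ∷ xs) h
    high : ∀ {x xs h} → Untouched B x → need M x ≤ suc D →
           Balanced M B D xs h → Balanced M B D (x ∷ xs) (suc h)

  Balanced-excess≤length : Balanced M B D xs h → h ≤ length xs
  Balanced-excess≤length []                = z≤n
  Balanced-excess≤length (low  _ _ rest) = m≤n⇒m≤1+n (Balanced-excess≤length rest)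
  Balanced-excess≤length (high _ _ rest) = s≤s (Balanced-excess≤length rest)

  Balanced-antimono : M ⊆ M′ → Balanced M B D xs h → Balanced M′ B D xs h
  Balanced-antimono M⊆M′ []                  = []
  Balanced-antimono M⊆M′ (low  u ≤D rest)   =
    low  u (≤-trans (need-antimono M⊆M′) ≤D)   (Balanced-antimono M⊆M′ rest)
  Balanced-antimono M⊆M′ (high u ≤1+D rest) =
    high u (≤-trans (need-antimono M⊆M′) ≤1+D) (Balanced-antimono M⊆M′ rest)

  Balanced-shiftLevel : Balanced M B (suc D) xs 0 → Balanced M B D xs (length xs)
  Balanced-shiftLevel []               = []
  Balanced-shiftLevel (low u ≤D rest) = high u ≤D (Balanced-shiftLevel rest)

  Balanced-lower : Balanced M B D xs (suc h) →
                   Balanced M B D xs h ⊎ ∃[ y ] (y ∉ M ∪ B × Balanced (M ∪ ⁅ y ⁆) B D xs h)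
  Balanced-lower (low u ≤D rest) =
    Sum.map (low u ≤D) (λ (y , y∉ , rest′) → y , y∉ , low u (≤-trans (need-antimono (p⊆p∪q ⁅ y ⁆)) ≤D) rest′)
            (Balanced-lower rest)
  Balanced-lower {M = M} (high {x = x} u ≤1+D rest) with nonempty? (missing M x)
  ... | no  none     = inj₁ (low u (subst (_≤ _) (sym (Empty⇒∣p∣≡0 none)) z≤n) rest)
  ... | yes (y , y∈) = inj₂ (y , claimable u y∈ ,
                             low u (≤-pred (<-≤-trans (need-claim y∈) ≤1+D)) (Balanced-antimono (p⊆p∪q ⁅ y ⁆) rest))

  Balanced-⊇ : ys Sublist.⊆ xs → Balanced M B D xs h → ∃[ h′ ] (h′ ≤ h × Balanced M B D ys h′)
  Balanced-⊇ []       []                 = 0 , z≤n , []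
  Balanced-⊇ (_ ∷ʳ σ) (low  _ _ rest)   = Balanced-⊇ σ rest
  Balanced-⊇ (_ ∷ʳ σ) (high _ _ rest) with Balanced-⊇ σ rest
  ... | h′ , h′≤h , ys = h′ , m≤n⇒m≤1+n h′≤h , ys
  Balanced-⊇ (refl ∷ σ) (low u ≤D rest) with Balanced-⊇ σ rest
  ... | h′ , h′≤h , ys = h′ , h′≤h , low u ≤D ys
  Balanced-⊇ (refl ∷ σ) (high u ≤1+D rest) with Balanced-⊇ σ rest
  ... | h′ , h′≤h , ys = suc h′ , s≤s h′≤h , high u ≤1+D ys

  Untouched-∪ : Untouched B x → Untouched C x → Untouched (B ∪ C) x
  Untouched-∪ {B} {C = C} uB uC y∈F y∈B∪C = [ uB y∈F , uC y∈F ]′ (x∈p∪q⁻ B C y∈B∪C)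

  Balanced-∪ : All (Untouched C) xs → Balanced M B D xs h → Balanced M (B ∪ C) D xs h
  Balanced-∪ []         []                  = []
  Balanced-∪ (uC ∷ uCs) (low  uB ≤D rest)   = low  (Untouched-∪ uB uC) ≤D (Balanced-∪ uCs rest)
  Balanced-∪ (uC ∷ uCs) (high uB ≤1+D rest) = high (Untouched-∪ uB uC) ≤1+D (Balanced-∪ uCs rest)

  private
    extend : ∀ {E T T′ L} → Untouched B x → need M x ≤ E →
             Finishable c M B ⊎ L * suc c ≤ T → E + T ≡ T′ → Finishable c M B ⊎ suc L * suc c ≤ T′
    extend {x = x} {c = c} {E} u ≤E rest E+T≡T′ with E ≤? c | rest
    ... | yes E≤c | _         = inj₁ (x , u , ≤-trans ≤E E≤c)
    ... | no  _   | inj₁ done = inj₁ done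
    ... | no  E≰c | inj₂ L≤T  = inj₂ (subst (_ ≤_) E+T≡T′ (+-mono-≤ (≰⇒> E≰c) L≤T))

  Balanced-finishable : Balanced M B D xs h →
                        Finishable c M B ⊎ length xs * suc c ≤ length xs * D + h
  Balanced-finishable [] = inj₂ z≤n
  Balanced-finishable {D = D} (low {xs = xs} {h} u ≤D rest) =
    extend {L = length xs} u ≤D (Balanced-finishable rest) (sym (+-assoc D (length xs * D) h))
  Balanced-finishable {D = D} (high {xs = xs} {h} u ≤1+D rest) =
    extend {L = length xs} u ≤1+D (Balanced-finishable rest)
      (trans (cong suc (sym (+-assoc D (length xs * D) h))) (sym (+-suc _ h)))

  record Caps (M B : Subset n) (r S : ℕ) : Set where
    field
      level excess : ℕ
      boxes        : List (Fin m)
      distinct     : AllPairs _≢_ boxes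
      size         : length boxes ≡ r
      balanced     : Balanced M B level boxes excess
      total        : r * level + excess ≡ S

  Caps-antimono : ∀ {r S} → M ⊆ M′ → Caps M B r S → Caps M′ B r S
  Caps-antimono M⊆M′ caps = record { Caps caps ; balanced = Balanced-antimono M⊆M′ (Caps.balanced caps) }

  Caps-finishable : ∀ {r S} → Caps M B r S → Finishable c M B ⊎ r * suc c ≤ S
  Caps-finishable record { size = refl ; balanced = balanced ; total = refl } = Balanced-finishable balanced

  private
    lower : ∀ {r S D h} → AllPairs _≢_ xs → length xs ≡ r → Balanced M B D xs (suc h) →
            r * D + suc h ≡ suc S → Caps M B r S ⊎ ∃[ y ] (y ∉ M ∪ B × Caps (M ∪ ⁅ y ⁆) B r S)
    lower {h = h} distinct size balanced total =
      Sum.map caps (λ (y , y∉ , balanced′) → y , y∉ , caps balanced′) (Balanced-lower balanced)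
      where
      caps : ∀ {M} → Balanced M _ _ _ h → Caps M _ _ _
      caps balanced′ = record { distinct = distinct ; size = size ; balanced = balanced′ ;
                                total = suc-injective (trans (sym (+-suc _ h)) total) }

  Caps-lower : ∀ {r S} → Caps M B r (suc S) → Caps M B r S ⊎ ∃[ y ] (y ∉ M ∪ B × Caps (M ∪ ⁅ y ⁆) B r S)
  Caps-lower record { excess = suc h ; distinct = distinct ; size = size ; balanced = balanced ; total = total } =
    lower distinct size balanced total
  Caps-lower {r = r} record { level = suc D ; excess = zero ; boxes = _ ∷ _
                            ; distinct = distinct ; size = size@refl ; balanced = balanced ; total = total } =
    lower distinct size (Balanced-shiftLevel balanced) (trans (lower-level r D) total)
    where
    lower-level : ∀ r D → r * D + r ≡ r * suc D + 0
    lower-level = solve-∀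
  Caps-lower {r = r} record { level = zero ; excess = zero ; total = total } =
    ⊥-elim (0≢1+n (trans (sym (trans (+-identityʳ (r * 0)) (*-zeroʳ r))) total))
  Caps-lower record { level = suc D ; excess = zero ; boxes = [] ; size = refl ; total = () }

  lowering-turn : ∀ t {c r S} → t ≤ c → Caps M B r (t + S) →
                  (∀ {M′} → M ⊆ M′ → Caps M′ B r S → BreakerToMove M′ B) → MakerTurn c M B
  lowering-turn zero {c} _ caps reply = claim-arbitrarily c (λ M⊆M′ → reply M⊆M′ (Caps-antimono M⊆M′ caps))
  lowering-turn (suc t) {suc c} (s≤s t≤c) caps reply with Caps-lower caps
  ... | inj₁ caps′            = lowering-turn t (m≤n⇒m≤1+n t≤c) caps′ reply
  ... | inj₂ (y , y∉ , caps′) =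
    claim y∉ (lowering-turn t t≤c caps′ (λ M∪y⊆M′ → reply (M∪y⊆M′ ∘ p⊆p∪q ⁅ y ⁆)))

  Caps-initial : ∀ {s} → (∀ x → ∣ F x ∣ ≤ s) → Caps ⊥ ⊥ m (m * s)
  Caps-initial {s} size≤ = record
    { boxes    = allFin m
    ; distinct = allFin⁺ m
    ; size     = length-tabulate id
    ; balanced = all-low (allFin m)
    ; total    = +-identityʳ (m * s)
    }
    where
    all-low : ∀ xs → Balanced ⊥ ⊥ s xs 0
    all-low []       = []
    all-low (x ∷ xs) = low (λ _ → ∉⊥) (≤-trans (∣p∩q∣≤∣p∣ (F x) _) (size≤ x)) (all-low xs)

  module _ (disjoint : ∀ i j → i ≢ j → Empty (F i ∩ F j)) where

    survivors : ∀ C xs → AllPairs _≢_ xs →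
                ∃[ ys ] (ys Sublist.⊆ xs × All (Untouched C) ys × length xs ≤ length ys + ∣ C ∣)
    survivors C []       []               = [] , [] , [] , z≤n
    survivors C (x ∷ xs) (x≢xs ∷ distinct) with nonempty? (F x ∩ C)
    ... | no untouched with survivors C xs distinct
    ...   | ys , ys⊆xs , untouched-ys , len =
      x ∷ ys , refl ∷ ys⊆xs , (λ y∈F y∈C → untouched (_ , x∈p∩q⁺ (y∈F , y∈C))) ∷ untouched-ys , s≤s len
    survivors C (x ∷ xs) (x≢xs ∷ distinct) | yes (y , y∈F∩C) with survivors (C - y) xs distinct
    ... | ys , ys⊆xs , untouched-ys , len =
      ys , x ∷ʳ ys⊆xs , All.zipWith untouched (All-resp-⊆ ys⊆xs x≢xs , untouched-ys) , len′
      where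
      y∈F = proj₁ (x∈p∩q⁻ (F x) C y∈F∩C)
      y∈C = proj₂ (x∈p∩q⁻ (F x) C y∈F∩C)
      untouched : ∀ {x′} → x ≢ x′ × Untouched (C - y) x′ → Untouched C x′
      untouched {x′} (x≢x′ , untouched-C-y) {z} z∈F′ z∈C with z Fin.≟ y
      ... | yes refl = disjoint x x′ x≢x′ (z , x∈p∩q⁺ (y∈F , z∈F′))
      ... | no  z≢y  = untouched-C-y z∈F′ (x∈p∧x≢y⇒x∈p-y z∈C z≢y)
      len′ : suc (length xs) ≤ length ys + ∣ C ∣
      len′ = begin
        suc (length xs)                ≤⟨ s≤s len ⟩
        suc (length ys + ∣ C - y ∣)     ≡⟨ +-suc (length ys) ∣ C - y ∣ ⟨
        length ys + suc ∣ C - y ∣       ≤⟨ +-monoʳ-≤ (length ys) (x∈p⇒∣p-x∣<∣p∣ y∈C) ⟩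
        length ys + ∣ C ∣               ∎
        where open ≤-Reasoning

    Caps-reply : ∀ {r S} → ∣ C ∣ ≤ β → Caps M B (β + r) S →
                 ∃[ S′ ] ((β + r) * S′ ≤ r * (S + β) × Caps M (B ∪ C) r S′)
    Caps-reply {C} {r = r} ∣C∣≤β record { level = D ; excess = h ; boxes = xs ; distinct = distinct
                                        ; size = size ; balanced = balanced ; total = refl }
      with survivors C xs distinct
    ... | ys , ys⊆xs , untouched , len
      with Balanced-⊇ (Sublist.⊆-trans (take-⊆ r ys) ys⊆xs) balanced
    ...   | h′ , h′≤h , balanced′ = r * D + h′ , balanced-removal β r D h h′ h′≤h h′≤r , record
      { distinct = AllPairs-resp-⊇ (Sublist.⊆-trans (take-⊆ r ys) ys⊆xs) distinct
      ; size     = size′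
      ; balanced = Balanced-∪ (All-resp-⊆ (take-⊆ r ys) untouched) balanced′
      ; total    = refl
      }
      where
      r≤ys : r ≤ length ys
      r≤ys = +-cancelˡ-≤ β r (length ys) (begin
        β + r              ≡⟨ size ⟨
        length xs          ≤⟨ len ⟩
        length ys + ∣ C ∣  ≤⟨ +-monoʳ-≤ (length ys) ∣C∣≤β ⟩
        length ys + β      ≡⟨ +-comm (length ys) β ⟩
        β + length ys      ∎)
        where open ≤-Reasoning
      size′ : length (take r ys) ≡ r
      size′ = trans (length-take r ys) (m≤n⇒m⊓n≡m r≤ys)
      h′≤r : h′ ≤ r
      h′≤r = subst (h′ ≤_) size′ (Balanced-excess≤length balanced′)

harmonicNumerator : ℕ → ℕ
harmonicNumerator zero    = 0
harmonicNumerator (suc m) = suc m * harmonicNumerator m + m !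

module Budget (a q : ℕ) (2[1+q]≤a : 2 * suc q ≤ a) where

  -- For r ≥ 2 boxes this is S ≤ q (r H_{r-2} + 4), multiplied through by (r - 2)!.
  WithinBudget : ℕ → ℕ → Set
  WithinBudget zero                S = ∅
  WithinBudget (suc zero)          S = S ≤ a
  WithinBudget (suc (suc j))       S = S * j ! ≤ q * ((2 + j) * harmonicNumerator j + 4 * j !)

  budget-initial : ∀ j s → s * j ! ≤ q * harmonicNumerator j → WithinBudget (2 + j) ((2 + j) * s)
  budget-initial j s s≤ = begin
    (2 + j) * s * j !                                  ≡⟨ *-assoc (2 + j) s (j !) ⟩
    (2 + j) * (s * j !)                                ≤⟨ *-monoʳ-≤ (2 + j) s≤ ⟩
    (2 + j) * (q * harmonicNumerator j)                ≡⟨ x∙yz≈y∙xz (2 + j) q (harmonicNumerator j) ⟩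
    q * ((2 + j) * harmonicNumerator j)                ≤⟨ *-monoʳ-≤ q (m≤m+n _ (4 * j !)) ⟩
    q * ((2 + j) * harmonicNumerator j + 4 * j !)      ∎
    where open ≤-Reasoning

  spend : ∀ S X F → (a + S) * F ≤ q * (X + 4 * F) → (S + 2) * F ≤ q * (X + 2 * F)
  spend S X F within = +-cancelʳ-≤ (2 * q * F) _ _ (begin
    (S + 2) * F + 2 * q * F      ≡⟨ *-distribʳ-+ F (S + 2) (2 * q) ⟨
    (S + 2 + 2 * q) * F          ≤⟨ *-monoˡ-≤ F (subst (_≤ a + S) (regroup S q) (+-monoˡ-≤ S 2[1+q]≤a)) ⟩
    (a + S) * F                  ≤⟨ within ⟩
    q * (X + 4 * F)              ≡⟨ split X F q ⟩
    q * (X + 2 * F) + 2 * q * F  ∎)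
    where
    open ≤-Reasoning
    regroup : ∀ S q → 2 * suc q + S ≡ S + 2 + 2 * q
    regroup = solve-∀
    split : ∀ X F q → q * (X + 4 * F) ≡ q * (X + 2 * F) + 2 * q * F
    split = solve-∀

  budget-step : ∀ r {S S′} → WithinBudget (3 + r) (a + S) → (3 + r) * S′ ≤ (1 + r) * (S + 2) →
                WithinBudget (1 + r) S′
  budget-step zero {S} {S′} within shrink = *-cancelˡ-≤ 3 (begin
    3 * S′              ≤⟨ shrink ⟩
    1 * (S + 2)         ≡⟨ *-comm 1 (S + 2) ⟩
    (S + 2) * 1         ≤⟨ spend S 3 1 within ⟩
    q * 5               ≤⟨ m≤m+n (q * 5) (q + 6) ⟩
    q * 5 + (q + 6)     ≡⟨ six q ⟩
    3 * (2 * suc q)     ≤⟨ *-monoʳ-≤ 3 2[1+q]≤a ⟩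
    3 * a               ∎)
    where
    open ≤-Reasoning
    six : ∀ q → q * 5 + (q + 6) ≡ 3 * (2 * suc q)
    six = solve-∀
  budget-step (suc j) {S} {S′} within shrink =
    *-cancelˡ-≤ (4 + j) (*-cancelˡ-≤ (1 + j) (*-cancelˡ-≤ (2 + j) (begin
      (2 + j) * ((1 + j) * ((4 + j) * (S′ * d)))                     ≡⟨ regroup j S′ d ⟩
      (4 + j) * S′ * d₂                                              ≤⟨ *-monoˡ-≤ d₂ shrink ⟩
      (2 + j) * (S + 2) * d₂                                         ≡⟨ *-assoc (2 + j) (S + 2) d₂ ⟩
      (2 + j) * ((S + 2) * d₂)                                       ≤⟨ *-monoʳ-≤ (2 + j) (spend S ((4 + j) * N₂) d₂ within) ⟩
      (2 + j) * (q * ((4 + j) * N₂ + 2 * d₂))                        ≤⟨ m≤m+n _ (3 * j * (2 + j) * d * q) ⟩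
      (2 + j) * (q * ((4 + j) * N₂ + 2 * d₂)) + 3 * j * (2 + j) * d * q ≡⟨ slack j q N d ⟩
      (2 + j) * ((1 + j) * ((4 + j) * (q * ((2 + j) * N + 4 * d))))  ∎)))
    where
    open ≤-Reasoning
    d  = j !
    N  = harmonicNumerator j
    d₂ = (2 + j) !
    N₂ = harmonicNumerator (2 + j)
    -- d₂ and N₂ unfold to the expressions in d and N that appear in these identities.
    regroup : ∀ j S′ d → (2 + j) * ((1 + j) * ((4 + j) * (S′ * d))) ≡ (4 + j) * S′ * ((2 + j) * ((1 + j) * d))
    regroup = solve-∀
    slack : ∀ j q N d →
            (2 + j) * (q * ((4 + j) * ((2 + j) * ((1 + j) * N + d) + (1 + j) * d) + 2 * ((2 + j) * ((1 + j) * d))))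
              + 3 * j * (2 + j) * d * q
            ≡ (2 + j) * ((1 + j) * ((4 + j) * (q * ((2 + j) * N + 4 * d))))
    slack = solve-∀

  budget-1 : ∀ {S} → WithinBudget 1 S → S < 1 * suc a
  budget-1 {S} S≤a = s≤s (subst (S ≤_) (sym (+-identityʳ a)) S≤a)

  budget-2 : ∀ {S} → WithinBudget 2 S → S < 2 * suc a
  budget-2 {S} within = begin-strict
    S               ≡⟨ *-identityʳ S ⟨
    S * 1           ≤⟨ within ⟩
    q * 4           <⟨ m<m+n (q * 4) {4} (s≤s z≤n) ⟩
    q * 4 + 4       ≡⟨ four q ⟩
    2 * (2 * suc q) ≤⟨ *-monoʳ-≤ 2 2[1+q]≤a ⟩
    2 * a           <⟨ m<m+n (2 * a) {2} (s≤s z≤n) ⟩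
    2 * a + 2       ≡⟨ two a ⟩
    2 * suc a       ∎
    where
    open ≤-Reasoning
    four : ∀ q → q * 4 + 4 ≡ 2 * (2 * suc q)
    four = solve-∀
    two : ∀ a → 2 * a + 2 ≡ 2 * suc a
    two = solve-∀

infixl 7 _/ᵘ_

_/ᵘ_ : ℕ → (d : ℕ) → .{{NonZero d}} → ℚᵘ
a /ᵘ d = + a ℚᵘ./ d

/ᵘ-nonNegative : ∀ a d .{{_ : NonZero d}} → ℚᵘ.NonNegative (a /ᵘ d)
/ᵘ-nonNegative a (suc d) = _

/ᵘ-+-/ᵘ : ∀ a b c d .{{_ : NonZero c}} .{{_ : NonZero d}} →
          a /ᵘ c ℚᵘ.+ b /ᵘ d ≡ ((a * d + b * c) /ᵘ (c * d)) {{m*n≢0 c d}}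
/ᵘ-+-/ᵘ a b (suc c) (suc d) = ℚᵘ.↥↧≡⇒≡ (sym (begin
  + (a * suc d + b * suc c)          ≡⟨ ℤ.pos-+ (a * suc d) (b * suc c) ⟩
  + (a * suc d) ℤ.+ + (b * suc c)    ≡⟨ cong₂ ℤ._+_ (ℤ.pos-* a (suc d)) (ℤ.pos-* b (suc c)) ⟩
  + a ℤ.* + suc d ℤ.+ + b ℤ.* + suc c ∎)) refl
  where open ≡-Reasoning

/ᵘ-*-/ᵘ : ∀ a b c d .{{_ : NonZero c}} .{{_ : NonZero d}} →
          (a /ᵘ c) ℚᵘ.* (b /ᵘ d) ≡ ((a * b) /ᵘ (c * d)) {{m*n≢0 c d}}
/ᵘ-*-/ᵘ a b (suc c) (suc d) = ℚᵘ.↥↧≡⇒≡ (sym (ℤ.pos-* a b)) refl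

drop-/ᵘ≤/ᵘ : ∀ {a b c d} .{{_ : NonZero c}} .{{_ : NonZero d}} → a /ᵘ c ℚᵘ.≤ b /ᵘ d → a * d ≤ b * c
drop-/ᵘ≤/ᵘ {a} {b} {suc c} {suc d} (*≤* a*d≤b*c) =
  ℤ.drop‿+≤+ (subst₂ ℤ._≤_ (sym (ℤ.pos-* a (suc d))) (sym (ℤ.pos-* b (suc c))) a*d≤b*c)

toℚᵘ-ℕ→ℚ : ∀ a → ℚ.toℚᵘ (ℕ→ℚ a) ℚᵘ.≃ a /ᵘ 1
toℚᵘ-ℕ→ℚ a = ℚ.toℚᵘ-fromℚᵘ (a /ᵘ 1)

toℚᵘ[p-1]≤p∸1 : ∀ p → ℚ.toℚᵘ (ℕ→ℚ p ℚ.- ℚ.1ℚ) ℚᵘ.≤ (p ∸ 1) /ᵘ 1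
toℚᵘ[p-1]≤p∸1 zero    = *≤* ℤ.-≤+
toℚᵘ[p-1]≤p∸1 (suc p) = ℚᵘ.≤-reflexive (begin
  ℚ.toℚᵘ (ℕ→ℚ (suc p) ℚ.- ℚ.1ℚ)              ≈⟨ ℚ.toℚᵘ-homo-+ (ℕ→ℚ (suc p)) (ℚ.- ℚ.1ℚ) ⟩
  ℚ.toℚᵘ (ℕ→ℚ (suc p)) ℚᵘ.+ ℚ.toℚᵘ (ℚ.- ℚ.1ℚ) ≈⟨ ℚᵘ.+-congˡ (ℚ.toℚᵘ (ℚ.- ℚ.1ℚ)) (toℚᵘ-ℕ→ℚ (suc p)) ⟩
  suc p /ᵘ 1 ℚᵘ.- 1 /ᵘ 1                        ≈⟨ *≡* (cong (λ x → + x ℤ.* + 1) (*-identityʳ p)) ⟩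
  p /ᵘ 1                                        ∎)
  where open import Relation.Binary.Reasoning.Setoid ℚᵘ.≃-setoid

toℚᵘ-H : ∀ m → ℚ.toℚᵘ (H m) ℚᵘ.≃ (harmonicNumerator m /ᵘ m !) {{m !≢0}}
toℚᵘ-H zero    = *≡* refl
toℚᵘ-H (suc m) = begin
  ℚ.toℚᵘ (H m ℚ.+ + 1 ℚ./ suc m)           ≈⟨ ℚ.toℚᵘ-homo-+ (H m) (+ 1 ℚ./ suc m) ⟩
  ℚ.toℚᵘ (H m) ℚᵘ.+ ℚ.toℚᵘ (+ 1 ℚ./ suc m) ≈⟨ ℚᵘ.+-cong (toℚᵘ-H m) (ℚ.toℚᵘ-fromℚᵘ (1 /ᵘ suc m)) ⟩
  N /ᵘ m ! ℚᵘ.+ 1 /ᵘ suc m                  ≡⟨ /ᵘ-+-/ᵘ N 1 (m !) (suc m) ⟩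
  (N * suc m + 1 * m !) /ᵘ (m ! * suc m)    ≡⟨ ℚᵘ./-cong (cong +_ (numerator N (m !))) (*-comm (m !) (suc m)) ⟩
  harmonicNumerator (suc m) /ᵘ suc m !      ∎
  where
  open import Relation.Binary.Reasoning.Setoid ℚᵘ.≃-setoid
  N = harmonicNumerator m
  numerator : ∀ h f → h * suc m + 1 * f ≡ suc m * h + f
  numerator = solve-∀
  instance
    _ = m !≢0
    _ = suc m !≢0
    _ = m*n≢0 (m !) (suc m)

harmonic-bound : ∀ s b m → ℕ→ℚ s ℚ.≤ halfMinusOne b ℚ.* H m →
                 s * m ! ≤ (b / 2 ∸ 1) * harmonicNumerator m
harmonic-bound s b m s≤ = subst₂ _≤_ (cong (s *_) (*-identityˡ (m !))) (*-identityʳ _) (drop-/ᵘ≤/ᵘ (begin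
  s /ᵘ 1                                   ≃⟨ toℚᵘ-ℕ→ℚ s ⟨
  ℚ.toℚᵘ (ℕ→ℚ s)                           ≤⟨ ℚ.toℚᵘ-mono-≤ s≤ ⟩
  ℚ.toℚᵘ (halfMinusOne b ℚ.* H m)          ≃⟨ ℚ.toℚᵘ-homo-* (halfMinusOne b) (H m) ⟩
  ℚ.toℚᵘ (halfMinusOne b) ℚᵘ.* ℚ.toℚᵘ (H m) ≃⟨ ℚᵘ.*-congˡ {ℚ.toℚᵘ (halfMinusOne b)} (toℚᵘ-H m) ⟩
  ℚ.toℚᵘ (halfMinusOne b) ℚᵘ.* (N /ᵘ m !)  ≤⟨ ℚᵘ.*-monoˡ-≤-nonNeg (N /ᵘ m !) (toℚᵘ[p-1]≤p∸1 (b / 2)) ⟩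
  (q /ᵘ 1) ℚᵘ.* (N /ᵘ m !)                 ≡⟨ /ᵘ-*-/ᵘ q N 1 (m !) ⟩
  (q * N) /ᵘ (1 * m !)                     ∎))
  where
  open ℚᵘ.≤-Reasoning
  q = b / 2 ∸ 1
  N = harmonicNumerator m
  instance
    _ = m !≢0
    _ = m*n≢0 1 (m !)
    _ = /ᵘ-nonNegative N (m !)

module Strategy (a q : ℕ) (2[1+q]≤a : 2 * suc q ≤ a) {m n : ℕ} (F : Fin m → Subset n)
                (disjoint : ∀ i j → i ≢ j → Empty (F i ∩ F j)) where

  open Budget a q 2[1+q]≤a
  open MakerBreaker a 2 F

  mutual
    win : ∀ r {M B S} → WithinBudget r S → Caps M B r S → MakerWins a 2 F M B
    win r budget caps = [ turn⇒wins ∘ finish a , play r budget caps ]′ (Caps-finishable caps)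

    play : ∀ r {M B S} → WithinBudget r S → Caps M B r S → r * suc a ≤ S → MakerWins a 2 F M B
    play 1 budget _ large = ⊥-elim (<⇒≱ (budget-1 budget) large)
    play 2 budget _ large = ⊥-elim (<⇒≱ (budget-2 budget) large)
    play (suc (suc (suc r))) {M} {B} {S} budget caps large =
      turn⇒wins (lowering-turn a ≤-refl (subst (Caps M B (3 + r)) (sym a+[S∸a]≡S) caps) λ _ caps₁ C _ ∣C∣≡ →
        let S′ , shrink , caps′ = Caps-reply disjoint (subst (_≤ 2) (sym ∣C∣≡) (m⊓n≤m 2 _)) caps₁
        in  win (suc r) (budget-step r (subst (WithinBudget (3 + r)) (sym a+[S∸a]≡S) budget) shrink) caps′)
      where
      a+[S∸a]≡S : a + (S ∸ a) ≡ S
      a+[S∸a]≡S = m+[n∸m]≡n (≤-trans (n≤1+n a) (≤-trans (m≤m+n (suc a) _) large))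

0<[1+s]*j! : ∀ s j → 0 < suc s * j !
0<[1+s]*j! s j = *-mono-≤ {1} {suc s} {1} {j !} (s≤s z≤n) (1≤n! j)

corollary3p2 : (n b k s : ℕ) (F : Fin (suc k) → Subset n) →
               (∀ i j → i ≢ j → Empty (F i ∩ F j)) →
               (∀ i → ∣ F i ∣ ≤ s) →
               ℕ→ℚ s ℚ.≤ halfMinusOne b ℚ.* H (k ∸ 1) →
               MakerWins b 2 F ⊥ ⊥
corollary3p2 n b k zero F _ size≤ _ =
  won Fin.zero (λ y∈F → ⊥-elim (<⇒≱ (x∈p⇒0<∣p∣ y∈F) (size≤ Fin.zero)))
corollary3p2 n b zero (suc s) F _ _ hyp =
  ⊥-elim (<⇒≱ (0<[1+s]*j! s 0) (subst (suc s * 1 ≤_) (*-zeroʳ (b / 2 ∸ 1)) (harmonic-bound (suc s) b 0 hyp)))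
corollary3p2 n b (suc j) (suc s) F disjoint size≤ hyp
  with b / 2 | subst (_≤ b) (*-comm (b / 2) 2) (m/n*n≤m b 2) | harmonic-bound (suc s) b j hyp
... | zero  | _        | bound = ⊥-elim (<⇒≱ (0<[1+s]*j! s j) bound)
... | suc q | 2[1+q]≤b | bound =
  Strategy.win b q 2[1+q]≤b F disjoint (2 + j)
    (Budget.budget-initial b q 2[1+q]≤b j (suc s) bound)
    (MakerBreaker.Caps-initial b 2 F size≤)
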